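{- Let $G$ be a graph and $H=\mathcal{I}(G)$. Suppose $H$ contains an induced subgraph isomorphic to $K_{1,m}$ with centre $X$ and leaves $Y_1,\dots,Y_m$, and that $\deg_H(X)=m$. Then for all $i\neq j$: (i) $X-Y_i\neq X-Y_j$; (ii) $|Y_i\cap Y_j|=i(G)-2$; and (iii) $m\le i(G)$.
   Context: All graphs are finite and simple. For a graph $G$, $i(G)$ denotes the minimum cardinality of an independent dominating set of $G$; an independent dominating set of cardinality $i(G)$ is an $i$-set of $G$. The $i$-graph $\mathcal{I}(G)$ of $G$ is the graph whose vertices are the $i$-sets of $G$, where two $i$-sets $S$ and $S'$ are adjacent if and only if there is an edge $xy\in E(G)$ with $S'=(S-\{x\})\cup\{y\}$. -}

module Defs where

open import Data.Nat using (ℕ; _≤_)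
open import Data.Fin using (Fin)
open import Data.Fin.Subset using (Subset; _∈_; _∪_; _-_; ⁅_⁆; ∣_∣)
open import Data.Product using (Σ; ∃; _×_)
open import Data.Sum using (_⊎_)
open import Relation.Nullary using (¬_)
open import Relation.Binary.PropositionalEquality using (_≡_; _≢_)

record Graph (n : ℕ) : Set₁ where
  field
    Adj   : Fin n → Fin n → Set
    sym   : ∀ {u v} → Adj u v → Adj v u
    irrefl : ∀ {u} → ¬ Adj u u
open Graph public

module _ {n : ℕ} (G : Graph n) where

  Independent : Subset n → Set
  Independent S = ∀ u v → u ∈ S → v ∈ S → ¬ Adj G u v

  Dominating : Subset n → Set
  Dominating S = ∀ v → v ∈ S ⊎ ∃ λ u → u ∈ S × Adj G u v

  IndepDom : Subset n → Set
  IndepDom S = Independent S × Dominating S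

  -- an i-set: an independent dominating set of minimum cardinality,
  -- so that ∣ S ∣ = i(G) for every i-set S
  ISet : Subset n → Set
  ISet S = IndepDom S × (∀ T → IndepDom T → ∣ S ∣ ≤ ∣ T ∣)

  -- adjacency in the i-graph I(G): S' = (S - {x}) ∪ {y} for an edge xy of G
  -- (S ≢ S' : I(G) is a simple graph, no loops)
  IAdj : Subset n → Subset n → Set
  IAdj S S' = ISet S × ISet S' × S ≢ S' ×
              ∃ λ x → ∃ λ y → Adj G x y × S' ≡ (S - x) ∪ ⁅ y ⁆

  HasIDegree : Subset n → ℕ → Set
  HasIDegree X d = Σ (Fin d → Subset n) λ f →
    (∀ k l → f k ≡ f l → k ≡ l) ×
    (∀ k → IAdj X (f k)) ×
    (∀ S → IAdj X S → ∃ λ k → f k ≡ S)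

{-# OPTIONS --safe #-}
-- Since i-sets all have cardinality i(G), no i-set properly contains another, so every edge
-- S T of I(G) is a genuine exchange T = (S - x) ∪ {y} with x ∈ S and y ∉ S.  Write the
-- leaves as Y_i = (X - x_i) ∪ {y_i}.  If x_i = x_j for i ≠ j, then y_j ∉ Y_i must be
-- dominated by y_i (a vertex of X - x_i would lie in Y_j next to y_j), so Y_j = (Y_i - y_i) ∪ {y_j}
-- and Y_i Y_j is an edge of I(G), contradicting that the star is induced.  Hence the x_i are distinct:
-- X ─ Y_i = {x_i} gives (i) and i ↦ x_i injects into X, giving (iii).  Moreover y_i ≠ y_j,
-- since otherwise x_j y_j would be an edge inside the independent set Y_i; therefore
-- Y_i ∩ Y_j = X - x_i - x_j, which is (ii).
module Submission where

open import Defs hiding (sym)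
open import Data.Nat using (ℕ; zero; suc; _≤_; _+_; z≤n; s≤s)
open import Data.Nat.Properties using (+-comm; <-irrefl; <-≤-trans)
open import Data.Fin using (Fin; _≟_) renaming (zero to fzero; suc to fsuc)
open import Data.Fin.Properties using (suc-injective)
open import Data.Fin.Subset
  using (Subset; _∈_; _∉_; _⊆_; _⊄_; _∩_; _∪_; _─_; _-_; ⁅_⁆; ∣_∣; inside; outside)
open import Data.Fin.Subset.Properties
open import Data.Vec.Base using (_∷_; here; there)
open import Data.Product using (_×_; _,_; proj₁; proj₂)
open import Data.Sum using (_⊎_; inj₁; inj₂)
open import Data.Empty using (⊥-elim)
open import Function using (_∘_)
open import Function.Definitions using (Injective)
open import Relation.Nullary using (¬_; yes; no; contradiction)
open import Relation.Binary.PropositionalEquality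
  using (_≡_; _≢_; refl; sym; cong; subst; module ≡-Reasoning)

private
  variable
    k : ℕ
    p : Subset k
    v x x′ y y′ z : Fin k

x∈p─q⇒x∉q : ∀ (p q : Subset k) → x ∈ p ─ q → x ∉ q
x∈p─q⇒x∉q (s ∷ p) (inside ∷ q) () here
x∈p─q⇒x∉q (s ∷ p) (inside ∷ q) (there x∈p─q) (there x∈q) = x∈p─q⇒x∉q p q x∈p─q x∈q
x∈p─q⇒x∉q (s ∷ p) (outside ∷ q) (there x∈p─q) (there x∈q) = x∈p─q⇒x∉q p q x∈p─q x∈q

x∈p-y⇒x≢y : ∀ (p : Subset k) → x ∈ p - y → x ≢ y
x∈p-y⇒x≢y {y = y} p x∈p-y refl = x∈p─q⇒x∉q p ⁅ y ⁆ x∈p-y (x∈⁅x⁆ y)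

⁅⁆-injective : ⁅ x ⁆ ≡ ⁅ y ⁆ → x ≡ y
⁅⁆-injective {x = x} {y} ⁅x⁆≡⁅y⁆ = x∈⁅y⁆⇒x≡y y (subst (x ∈_) ⁅x⁆≡⁅y⁆ (x∈⁅x⁆ x))

x∈p⇒suc∣p-x∣≡∣p∣ : ∀ (p : Subset k) → x ∈ p → suc ∣ p - x ∣ ≡ ∣ p ∣
x∈p⇒suc∣p-x∣≡∣p∣ {x = fzero}  (inside ∷ p)  here        = cong suc (cong ∣_∣ (p─⊥≡p p))
x∈p⇒suc∣p-x∣≡∣p∣ {x = fsuc x} (inside ∷ p)  (there x∈p) = cong suc (x∈p⇒suc∣p-x∣≡∣p∣ p x∈p)
x∈p⇒suc∣p-x∣≡∣p∣ {x = fsuc x} (outside ∷ p) (there x∈p) = x∈p⇒suc∣p-x∣≡∣p∣ p x∈p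

∣p-x-y∣+2≡∣p∣ : x ∈ p → y ∈ p → x ≢ y → ∣ p - x - y ∣ + 2 ≡ ∣ p ∣
∣p-x-y∣+2≡∣p∣ {x = x} {p = p} {y = y} x∈p y∈p x≢y = begin
  ∣ p - x - y ∣ + 2       ≡⟨ +-comm ∣ p - x - y ∣ 2 ⟩
  suc (suc ∣ p - x - y ∣) ≡⟨ cong suc (x∈p⇒suc∣p-x∣≡∣p∣ (p - x) (x∈p∧x≢y⇒x∈p-y y∈p (x≢y ∘ sym))) ⟩
  suc ∣ p - x ∣           ≡⟨ x∈p⇒suc∣p-x∣≡∣p∣ p x∈p ⟩
  ∣ p ∣                   ∎
  where open ≡-Reasoning

injective⇒≤∣p∣ : ∀ {m} (p : Subset k) (f : Fin m → Fin k) →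
                 Injective _≡_ _≡_ f → (∀ a → f a ∈ p) → m ≤ ∣ p ∣
injective⇒≤∣p∣ {m = zero}  p f f-inj f∈p = z≤n
injective⇒≤∣p∣ {m = suc m} p f f-inj f∈p =
  subst (suc m ≤_) (x∈p⇒suc∣p-x∣≡∣p∣ p (f∈p fzero))
    (s≤s (injective⇒≤∣p∣ (p - f fzero) (f ∘ fsuc) (suc-injective ∘ f-inj)
      (λ a → x∈p∧x≢y⇒x∈p-y (f∈p (fsuc a)) (fsuc≢fzero ∘ f-inj))))
  where
  fsuc≢fzero : ∀ {a : Fin m} → fsuc a ≢ fzero
  fsuc≢fzero ()

swap : Subset k → Fin k → Fin k → Subset k
swap p x y = (p - x) ∪ ⁅ y ⁆

∈-swap⁻ : ∀ (p : Subset k) → v ∈ swap p x y → (v ∈ p × v ≢ x) ⊎ v ≡ y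
∈-swap⁻ {x = x} {y = y} p v∈swap with x∈p∪q⁻ (p - x) ⁅ y ⁆ v∈swap
... | inj₁ v∈p-x = inj₁ (p─q⊆p p ⁅ x ⁆ v∈p-x , x∈p-y⇒x≢y p v∈p-x)
... | inj₂ v∈⁅y⁆ = inj₂ (x∈⁅y⁆⇒x≡y y v∈⁅y⁆)

∈-swap⁺ : (v ∈ p × v ≢ x) ⊎ v ≡ y → v ∈ swap p x y
∈-swap⁺ (inj₁ (v∈p , v≢x)) = x∈p∪q⁺ (inj₁ (x∈p∧x≢y⇒x∈p-y v∈p v≢x))
∈-swap⁺ {y = y} (inj₂ refl) = x∈p∪q⁺ (inj₂ (x∈⁅x⁆ y))

y∈swap : y ∈ swap p x y
y∈swap = ∈-swap⁺ (inj₂ refl)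

∉-swap : v ∉ p ⊎ v ≡ x → v ≢ y → v ∉ swap p x y
∉-swap {p = p} v∉p⊎v≡x v≢y v∈swap with ∈-swap⁻ p v∈swap | v∉p⊎v≡x
... | inj₁ (v∈p , _) | inj₁ v∉p = v∉p v∈p
... | inj₁ (_ , v≢x) | inj₂ v≡x = v≢x v≡x
... | inj₂ v≡y       | _        = v≢y v≡y

y∈p⇒swap⊆p : y ∈ p → swap p x y ⊆ p
y∈p⇒swap⊆p {p = p} y∈p v∈swap with ∈-swap⁻ p v∈swap
... | inj₁ (v∈p , _) = v∈p
... | inj₂ refl      = y∈p

x∉p⇒p⊆swap : x ∉ p → p ⊆ swap p x y
x∉p⇒p⊆swap x∉p v∈p = ∈-swap⁺ (inj₁ (v∈p , λ { refl → x∉p v∈p }))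

swap-swap : y ∉ p → swap (swap p x y) y z ≡ swap p x z
swap-swap {y = y} {p = p} y∉p = ⊆-antisym lhs⊆rhs rhs⊆lhs
  where
  lhs⊆rhs : swap (swap p _ y) y _ ⊆ swap p _ _
  lhs⊆rhs v∈lhs with ∈-swap⁻ (swap p _ y) v∈lhs
  ... | inj₂ v≡z = ∈-swap⁺ (inj₂ v≡z)
  ... | inj₁ (v∈swap , v≢y) with ∈-swap⁻ p v∈swap
  ...   | inj₁ v∈p-x = ∈-swap⁺ (inj₁ v∈p-x)
  ...   | inj₂ v≡y   = contradiction v≡y v≢y
  rhs⊆lhs : swap p _ _ ⊆ swap (swap p _ y) y _
  rhs⊆lhs v∈rhs with ∈-swap⁻ p v∈rhs
  ... | inj₂ v≡z         = ∈-swap⁺ (inj₂ v≡z)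
  ... | inj₁ (v∈p , v≢x) = ∈-swap⁺ (inj₁ (∈-swap⁺ (inj₁ (v∈p , v≢x)) , λ { refl → y∉p v∈p }))

p─swap≡⁅x⁆ : x ∈ p → y ∉ p → p ─ swap p x y ≡ ⁅ x ⁆
p─swap≡⁅x⁆ {x = x} {p = p} {y = y} x∈p y∉p = ⊆-antisym lhs⊆rhs rhs⊆lhs
  where
  lhs⊆rhs : p ─ swap p x y ⊆ ⁅ x ⁆
  lhs⊆rhs {v} v∈p─swap with v ≟ x
  ... | yes refl = x∈⁅x⁆ x
  ... | no v≢x   = contradiction (∈-swap⁺ (inj₁ (p─q⊆p p _ v∈p─swap , v≢x)))
                                 (x∈p─q⇒x∉q p (swap p x y) v∈p─swap)
  rhs⊆lhs : ⁅ x ⁆ ⊆ p ─ swap p x y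
  rhs⊆lhs v∈⁅x⁆ with x∈⁅y⁆⇒x≡y x v∈⁅x⁆
  ... | refl = x∈p∧x∉q⇒x∈p─q x∈p (∉-swap (inj₂ refl) λ { refl → y∉p x∈p })

swap∩swap≡p-x-x′ : x ≢ x′ → y ∉ p → y′ ∉ p → y ≢ y′ →
                   swap p x y ∩ swap p x′ y′ ≡ p - x - x′
swap∩swap≡p-x-x′ {x = x} {x′ = x′} {y = y} {p = p} {y′ = y′} x≢x′ y∉p y′∉p y≢y′ =
  ⊆-antisym lhs⊆rhs rhs⊆lhs
  where
  lhs⊆rhs : swap p x y ∩ swap p x′ y′ ⊆ p - x - x′
  lhs⊆rhs v∈∩ with x∈p∩q⁻ (swap p x y) _ v∈∩
  ... | v∈swap , v∈swap′ with ∈-swap⁻ p v∈swap | ∈-swap⁻ p v∈swap′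
  ... | inj₁ (v∈p , v≢x) | inj₁ (_ , v≢x′) = x∈p∧x≢y⇒x∈p-y (x∈p∧x≢y⇒x∈p-y v∈p v≢x) v≢x′
  ... | inj₁ (v∈p , _)   | inj₂ refl       = contradiction v∈p y′∉p
  ... | inj₂ refl        | inj₁ (v∈p , _)  = contradiction v∈p y∉p
  ... | inj₂ refl        | inj₂ y≡y′       = contradiction y≡y′ y≢y′
  rhs⊆lhs : p - x - x′ ⊆ swap p x y ∩ swap p x′ y′
  rhs⊆lhs v∈p-x-x′ with p─q⊆p (p - x) _ v∈p-x-x′
  ... | v∈p-x = x∈p∩q⁺ ( ∈-swap⁺ (inj₁ (p─q⊆p p _ v∈p-x , x∈p-y⇒x≢y p v∈p-x))
                       , ∈-swap⁺ (inj₁ (p─q⊆p p _ v∈p-x , x∈p-y⇒x≢y (p - x) v∈p-x-x′)))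

module _ {n : ℕ} (G : Graph n) where

  private
    variable
      S T X Y Y′ : Subset n

  record Exchange (S T : Subset n) : Set where
    constructor exchange
    field
      leaving    : Fin n
      entering   : Fin n
      edge       : Adj G leaving entering
      leaving∈S  : leaving ∈ S
      entering∉S : entering ∉ S
      T≡swap     : T ≡ swap S leaving entering
  open Exchange public

  adjacent⇒≢ : ∀ {u w} → Adj G u w → u ≢ w
  adjacent⇒≢ uw refl = irrefl G uw

  ISet-⊄ : ISet G S → ISet G T → S ⊄ T
  ISet-⊄ (S-indDom , _) (_ , T-minimum) S⊂T =
    <-irrefl refl (<-≤-trans (p⊂q⇒∣p∣<∣q∣ S⊂T) (T-minimum _ S-indDom))

  IAdj⇒Exchange : IAdj G S T → Exchange S T
  IAdj⇒Exchange {S} (S-iset , T-iset , S≢T , x , y , xy , refl) with x ∈? S | y ∈? S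
  ... | yes x∈S | no y∉S  = exchange x y xy x∈S y∉S refl
  ... | yes x∈S | yes y∈S =
    ⊥-elim (ISet-⊄ T-iset S-iset (y∈p⇒swap⊆p y∈S , x , x∈S , ∉-swap (inj₂ refl) (adjacent⇒≢ xy)))
  ... | no x∉S  | no y∉S  = ⊥-elim (ISet-⊄ S-iset T-iset (x∉p⇒p⊆swap x∉S , y , y∈swap , y∉S))
  ... | no x∉S  | yes y∈S = ⊥-elim (S≢T (⊆-antisym (x∉p⇒p⊆swap x∉S) (y∈p⇒swap⊆p y∈S)))

  X─Y≡⁅leaving⁆ : (e : Exchange X Y) → X ─ Y ≡ ⁅ leaving e ⁆
  X─Y≡⁅leaving⁆ (exchange x y _ x∈X y∉X refl) = p─swap≡⁅x⁆ x∈X y∉X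

  leaving≡⇒IAdj : (e : Exchange X Y) (e′ : Exchange X Y′) → ISet G Y → ISet G Y′ → Y ≢ Y′ →
                  leaving e ≡ leaving e′ → IAdj G Y Y′
  leaving≡⇒IAdj {X} (exchange x y _ _ y∉X refl) (exchange _ y′ _ _ y′∉X refl)
                Y-iset Y′-iset Y≢Y′ refl =
    Y-iset , Y′-iset , Y≢Y′ , y , y′ , yy′ , sym (swap-swap y∉X)
    where
    y′≢y : y′ ≢ y
    y′≢y refl = Y≢Y′ refl
    yy′ : Adj G y y′
    yy′ with proj₂ (proj₁ Y-iset) y′
    ... | inj₁ y′∈Y = contradiction y′∈Y (∉-swap (inj₁ y′∉X) y′≢y)
    ... | inj₂ (u , u∈Y , uy′) with ∈-swap⁻ X u∈Y
    ...   | inj₁ u∈X-x = ⊥-elim (proj₁ (proj₁ Y′-iset) u y′ (∈-swap⁺ (inj₁ u∈X-x)) y∈swap uy′)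
    ...   | inj₂ refl  = uy′

  leaving≢⇒entering≢ : (e : Exchange X Y) (e′ : Exchange X Y′) → Independent G Y →
                       leaving e ≢ leaving e′ → entering e ≢ entering e′
  leaving≢⇒entering≢ (exchange x y _ _ _ refl) (exchange x′ _ x′y x′∈X _ refl) Y-indep x≢x′ refl =
    Y-indep x′ y (∈-swap⁺ (inj₁ (x′∈X , x≢x′ ∘ sym))) y∈swap x′y

  Y∩Y′≡X-leaving-leaving : (e : Exchange X Y) (e′ : Exchange X Y′) → Independent G Y →
                           leaving e ≢ leaving e′ → Y ∩ Y′ ≡ X - leaving e - leaving e′
  Y∩Y′≡X-leaving-leaving e@(exchange _ _ _ _ y∉X refl) e′@(exchange _ _ _ _ y′∉X refl) Y-indep x≢x′ =
    swap∩swap≡p-x-x′ x≢x′ y∉X y′∉X (leaving≢⇒entering≢ e e′ Y-indep x≢x′)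

  X─Y≢X─Y′ : (e : Exchange X Y) (e′ : Exchange X Y′) →
             leaving e ≢ leaving e′ → X ─ Y ≢ X ─ Y′
  X─Y≢X─Y′ {X} {Y} {Y′} e e′ x≢x′ X─Y≡X─Y′ = x≢x′ (⁅⁆-injective (begin
    ⁅ leaving e ⁆  ≡⟨ sym (X─Y≡⁅leaving⁆ e) ⟩
    X ─ Y          ≡⟨ X─Y≡X─Y′ ⟩
    X ─ Y′         ≡⟨ X─Y≡⁅leaving⁆ e′ ⟩
    ⁅ leaving e′ ⁆ ∎))
    where open ≡-Reasoning

  ∣Y∩Y′∣+2≡∣X∣ : (e : Exchange X Y) (e′ : Exchange X Y′) → Independent G Y →
                 leaving e ≢ leaving e′ → ∣ Y ∩ Y′ ∣ + 2 ≡ ∣ X ∣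
  ∣Y∩Y′∣+2≡∣X∣ {X} {Y} {Y′} e e′ Y-indep x≢x′ = begin
    ∣ Y ∩ Y′ ∣ + 2                      ≡⟨ cong (λ s → ∣ s ∣ + 2) (Y∩Y′≡X-leaving-leaving e e′ Y-indep x≢x′) ⟩
    ∣ X - leaving e - leaving e′ ∣ + 2  ≡⟨ ∣p-x-y∣+2≡∣p∣ (leaving∈S e) (leaving∈S e′) x≢x′ ⟩
    ∣ X ∣                               ∎
    where open ≡-Reasoning

lemma2p5 : ∀ {n : ℕ} (G : Graph n) (m : ℕ) (X : Subset n) (Y : Fin m → Subset n) →
    ISet G X →
    (∀ i → ISet G (Y i)) →
    (∀ i j → Y i ≡ Y j → i ≡ j) →
    (∀ i → IAdj G X (Y i)) →
    (∀ i j → i ≢ j → ¬ IAdj G (Y i) (Y j)) →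
    HasIDegree G X m →
    (∀ i j → i ≢ j → ((X ─ Y i) ≢ (X ─ Y j)) × (∣ Y i ∩ Y j ∣ + 2 ≡ ∣ X ∣)) × (m ≤ ∣ X ∣)
lemma2p5 {n} G m X Y _ Y-iset Y-injective X-Y Y-nonadjacent _ =
  (λ i j i≢j → X─Y≢X─Y′ G (e i) (e j) (i≢j ∘ xs-injective)
             , ∣Y∩Y′∣+2≡∣X∣ G (e i) (e j) (proj₁ (proj₁ (Y-iset i))) (i≢j ∘ xs-injective))
  , injective⇒≤∣p∣ X xs xs-injective (leaving∈S ∘ e)
  where
  e : ∀ i → Exchange G X (Y i)
  e i = IAdj⇒Exchange G (X-Y i)

  xs : Fin m → Fin n
  xs i = leaving (e i)

  xs-injective : Injective _≡_ _≡_ xs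
  xs-injective {i} {j} xsi≡xsj with i ≟ j
  ... | yes i≡j = i≡j
  ... | no i≢j  = ⊥-elim (Y-nonadjacent i j i≢j
    (leaving≡⇒IAdj G (e i) (e j) (Y-iset i) (Y-iset j) (i≢j ∘ Y-injective i j) xsi≡xsj))
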